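{- Let $D=(V,A)$ be a digraph, let $uv\in A$, and let $D'=(V,A')$ with $A'=(A\setminus\{uv\})\cup\{vu\}$ (the digraph obtained by reversing the arc $uv$). Then $\gamma^+_{maj}(D)-2\leq \gamma^+_{maj}(D')\leq \gamma^+_{maj}(D)+2$. Moreover, both bounds are sharp (each is attained for some digraph $D$ and arc $uv$).
   Context: Digraphs are finite, without loops or multiple arcs (pairs of opposite arcs allowed). For $u\in V$, $N^+[u]=\{u\}\cup\{v: uv\in A\}$. For $f:V\to\{ -1,1\}$ and $X\subseteq V$, $f(X)=\sum_{v\in X}f(v)$. A majority out-dominating function (MODF) of $D$ is a function $f:V\to\{ -1,1\}$ with $|\{v\in V: f(N^+[v])\geq1\}|\geq |V|/2$; its weight is $w(f)=f(V)$. $\gamma^+_{maj}(D)$ is the minimum weight of a MODF of $D$. -}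

module Defs where

open import Data.Nat using (ℕ)
import Data.Nat as ℕ
open import Data.Bool using (Bool; true; false; if_then_else_; _∧_)
open import Data.Fin using (Fin; _≟_)
open import Data.List using (List; []; _∷_; map; foldr; filter; length; allFin)
open import Data.Integer using (ℤ; +_; -[1+_]; _≤_; 0ℤ; 1ℤ)
import Data.Integer as ℤ
open import Data.Product using (Σ; _×_)
open import Relation.Nullary using (¬_)
open import Relation.Nullary.Decidable using (⌊_⌋)
open import Relation.Binary.PropositionalEquality using (_≡_)

-- A digraph on vertex set V = Fin n, given by its (decidable) arc relation:
-- arc x y ≡ true  iff  xy ∈ A.  Pairs of opposite arcs are allowed.
Digraph : ℕ → Set
Digraph n = Fin n → Fin n → Bool

Loopless : ∀ {n} → Digraph n → Set
Loopless {n} D = (x : Fin n) → D x x ≡ false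

reverseArc : ∀ {n} → Digraph n → Fin n → Fin n → Digraph n
reverseArc D u v x y =
  if ⌊ x ≟ v ⌋ ∧ ⌊ y ≟ u ⌋ then true
  else if ⌊ x ≟ u ⌋ ∧ ⌊ y ≟ v ⌋ then false
  else D x y

sumℤ : List ℤ → ℤ
sumℤ = foldr ℤ._+_ 0ℤ

-- Functions f : V → {-1,1}, encoded as V → Bool (true ↦ 1, false ↦ -1).
SignFun : ℕ → Set
SignFun n = Fin n → Bool

val : Bool → ℤ
val true  = 1ℤ
val false = -[1+ 0 ]

weight : ∀ {n} → SignFun n → ℤ
weight {n} f = sumℤ (map (λ w → val (f w)) (allFin n))

closedOutSum : ∀ {n} → Digraph n → SignFun n → Fin n → ℤ
closedOutSum {n} D f x =
  val (f x) ℤ.+ sumℤ (map (λ w → if D x w then val (f w) else 0ℤ) (allFin n))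

goodCount : ∀ {n} → Digraph n → SignFun n → ℕ
goodCount {n} D f = length (filter (λ x → 1ℤ ℤ.≤? closedOutSum D f x) (allFin n))

-- MODF:  |{x : f(N⁺[x]) ≥ 1}| ≥ |V|/2, i.e. 2·count ≥ |V|.
IsMODF : ∀ {n} → Digraph n → SignFun n → Set
IsMODF {n} D f = n ℕ.≤ 2 ℕ.* goodCount D f

IsGammaMaj : ∀ {n} → Digraph n → ℤ → Set
IsGammaMaj {n} D k =
  Σ (SignFun n) (λ f → IsMODF D f × weight f ≡ k)
  × ((f : SignFun n) → IsMODF D f → k ≤ weight f)

module Submission where

-- Core (module Reversal): let D₂ agree with D₁ outside the entries (a,b),
-- (b,a), and contain the arc ba.  Every MODF f of D₁ becomes a MODF g of D₂
-- with w(g) ≤ w(f) + 2 by raising at most one value to +1: raise a if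
-- f(a) = -1; else raise a D₂-out-neighbour w of a with f(w) = -1 if there is
-- one; else g = f, as a is then good in D₂.  Always f ≤ g and g(a) = +1, so
-- vertices x ≠ a stay good (b's new arc points at a positive vertex), while a
-- loses at most 2 from the arc ab, which the raise compensates.
-- Reversing uv fits this pattern both from D to D' and from D' to D, giving
-- the two bounds.  Sharpness: the 2-cycle and
-- the transitive triangle, checked by exhaustive search over sign functions.

open import Defs
open import Data.Nat using (ℕ; zero; suc)
import Data.Nat as ℕ
import Data.Nat.Properties as ℕP
open import Data.Bool using (Bool; true; false; if_then_else_; _∧_)
import Data.Bool.Properties as BoolP
open import Data.Fin using (Fin; zero; suc; _≟_)
open import Data.Fin.Properties using (any?; suc-injective)
open import Data.List using (List; []; _∷_; filter; length; allFin; tabulate)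
import Data.List.Properties as ListP
open import Data.Vec using (Vec; []; _∷_; lookup)
import Data.Vec as Vec
open import Data.Vec.Properties using (lookup∘tabulate)
open import Data.Integer using (ℤ; +_; -[1+_]; 0ℤ; 1ℤ; _+_; _-_; -_; _≤_; +≤+; -≤+)
import Data.Integer as ℤ
import Data.Integer.Properties as ℤP
open import Algebra.Properties.CommutativeSemigroup ℤP.+-commutativeSemigroup using (xy∙z≈xz∙y)
open import Data.Product using (Σ; _×_; _,_; ∃)
open import Data.Empty using (⊥-elim)
open import Relation.Nullary using (¬_; yes; no; Dec)
open import Relation.Nullary.Decidable using (⌊_⌋; _×-dec_; _→-dec_; map′; True; toWitness)
open import Relation.Binary.PropositionalEquality

private
  variable
    n : ℕ

sumFin : (Fin n → ℤ) → ℤ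
sumFin g = sumℤ (tabulate g)

sumFin-mono : (g h : Fin n → ℤ) → (∀ z → g z ≤ h z) → sumFin g ≤ sumFin h
sumFin-mono {zero}  g h g≤h = ℤP.≤-refl
sumFin-mono {suc n} g h g≤h =
  ℤP.+-mono-≤ (g≤h zero) (sumFin-mono (λ z → g (suc z)) (λ z → h (suc z)) (λ z → g≤h (suc z)))

sumFin-≤-except : (g h : Fin n → ℤ) (y : Fin n) (c d : ℤ) →
  (∀ z → z ≢ y → g z ≤ h z) → g y + c ≤ h y + d → sumFin g + c ≤ sumFin h + d
sumFin-≤-except {suc n} g h zero c d g≤h at-y = begin
  (g zero + G) + c   ≡⟨ xy∙z≈xz∙y (g zero) G c ⟩
  (g zero + c) + G   ≤⟨ ℤP.+-mono-≤ at-y (sumFin-mono _ _ λ z → g≤h (suc z) λ ()) ⟩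
  (h zero + d) + H   ≡⟨ xy∙z≈xz∙y (h zero) d H ⟩
  (h zero + H) + d   ∎
  where
  open ℤP.≤-Reasoning
  G H : ℤ
  G = sumFin λ z → g (suc z)
  H = sumFin λ z → h (suc z)
sumFin-≤-except {suc n} g h (suc y) c d g≤h at-y = begin
  (g zero + G) + c   ≡⟨ ℤP.+-assoc (g zero) G c ⟩
  g zero + (G + c)   ≤⟨ ℤP.+-mono-≤ (g≤h zero λ ()) rest ⟩
  h zero + (H + d)   ≡⟨ ℤP.+-assoc (h zero) H d ⟨
  (h zero + H) + d   ∎
  where
  open ℤP.≤-Reasoning
  G H : ℤ
  G = sumFin λ z → g (suc z)
  H = sumFin λ z → h (suc z)
  rest : G + c ≤ H + d
  rest = sumFin-≤-except (λ z → g (suc z)) (λ z → h (suc z)) y c d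
           (λ z z≢y → g≤h (suc z) (λ e → z≢y (suc-injective e))) at-y

_⊑_ : SignFun n → SignFun n → Set
f ⊑ g = ∀ z → f z ≡ true → g z ≡ true

⊑-refl : (f : SignFun n) → f ⊑ f
⊑-refl f z fz = fz

val-mono : (b c : Bool) → (b ≡ true → c ≡ true) → val b ≤ val c
val-mono true  c b⇒c rewrite b⇒c refl = ℤP.≤-refl
val-mono false true  _ = -≤+
val-mono false false _ = ℤP.≤-refl

term : Digraph n → SignFun n → Fin n → Fin n → ℤ
term D f x w = if D x w then val (f w) else 0ℤ

outSum : Digraph n → SignFun n → Fin n → ℤ
outSum D f x = sumFin (term D f x)

term≤1 : (D : Digraph n) (f : SignFun n) (x w : Fin n) → term D f x w ≤ 1ℤ
term≤1 D f x w with D x w | f w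
... | true  | true  = ℤP.≤-refl
... | true  | false = -≤+
... | false | _     = +≤+ ℕ.z≤n

-1≤term : (D : Digraph n) (f : SignFun n) (x w : Fin n) → -[1+ 0 ] ≤ term D f x w
-1≤term D f x w with D x w | f w
... | true  | true  = -≤+
... | true  | false = ℤP.≤-refl
... | false | _     = -≤+

term-slack : (D₁ D₂ : Digraph n) (f g : SignFun n) (x w : Fin n) →
  term D₁ f x w ≤ term D₂ g x w + + 2
term-slack D₁ D₂ f g x w =
  ℤP.≤-trans (term≤1 D₁ f x w) (ℤP.+-monoˡ-≤ (+ 2) (-1≤term D₂ g x w))

term-mono : (D₁ D₂ : Digraph n) (f g : SignFun n) (x w : Fin n) →
  D₁ x w ≡ D₂ x w → f ⊑ g → term D₁ f x w ≤ term D₂ g x w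
term-mono D₁ D₂ f g x w same f⊑g rewrite same with D₂ x w
... | true  = val-mono (f w) (g w) (f⊑g w)
... | false = ℤP.≤-refl

term-max : (D₁ D₂ : Digraph n) (f g : SignFun n) (x w : Fin n) →
  D₂ x w ≡ true → g w ≡ true → term D₁ f x w ≤ term D₂ g x w
term-max D₁ D₂ f g x w xw∈D₂ gw rewrite xw∈D₂ | gw = term≤1 D₁ f x w

closedOutSum-split : (D : Digraph n) (f : SignFun n) (x : Fin n) →
  closedOutSum D f x ≡ val (f x) + outSum D f x
closedOutSum-split D f x =
  cong (λ l → val (f x) + sumℤ l) (ListP.map-tabulate (λ w → w) (term D f x))

closedOutSum-mono : (D₁ D₂ : Digraph n) (f g : SignFun n) (x : Fin n) → f ⊑ g →
  (∀ w → term D₁ f x w ≤ term D₂ g x w) → closedOutSum D₁ f x ≤ closedOutSum D₂ g x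
closedOutSum-mono D₁ D₂ f g x f⊑g terms
  rewrite closedOutSum-split D₁ f x | closedOutSum-split D₂ g x =
  ℤP.+-mono-≤ (val-mono (f x) (g x) (f⊑g x)) (sumFin-mono (term D₁ f x) (term D₂ g x) terms)

Good : Digraph n → SignFun n → Fin n → Set
Good D f x = 1ℤ ≤ closedOutSum D f x

positive-closed-neighbourhood : (D : Digraph n) (f : SignFun n) (x : Fin n) → f x ≡ true →
  ¬ ∃ (λ w → D x w ≡ true × f w ≡ false) → Good D f x
positive-closed-neighbourhood {n} D f x fx no-negative
  rewrite closedOutSum-split D f x | fx =
  ℤP.+-monoʳ-≤ 1ℤ (subst (_≤ outSum D f x) (sumFin-zero n) (sumFin-mono _ _ nonnegative))
  where
  sumFin-zero : ∀ m → sumFin {m} (λ _ → 0ℤ) ≡ 0ℤ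
  sumFin-zero zero    = refl
  sumFin-zero (suc m) = cong (λ s → 0ℤ + s) (sumFin-zero m)
  nonnegative : ∀ w → 0ℤ ≤ term D f x w
  nonnegative w with D x w in xw | f w in fw
  ... | false | _     = ℤP.≤-refl
  ... | true  | true  = +≤+ ℕ.z≤n
  ... | true  | false = ⊥-elim (no-negative (w , xw , fw))

count-mono : {A : Set} (s₁ s₂ : A → ℤ) → (∀ x → 1ℤ ≤ s₁ x → 1ℤ ≤ s₂ x) → (l : List A) →
  length (filter (λ x → 1ℤ ℤ.≤? s₁ x) l) ℕ.≤ length (filter (λ x → 1ℤ ℤ.≤? s₂ x) l)
count-mono s₁ s₂ imp [] = ℕ.z≤n
count-mono s₁ s₂ imp (x ∷ l) with 1ℤ ℤ.≤? s₁ x | 1ℤ ℤ.≤? s₂ x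
... | yes _  | yes _  = ℕ.s≤s (count-mono s₁ s₂ imp l)
... | yes p  | no ¬q  = ⊥-elim (¬q (imp x p))
... | no _   | yes _  = ℕP.m≤n⇒m≤1+n (count-mono s₁ s₂ imp l)
... | no _   | no _   = count-mono s₁ s₂ imp l

IsMODF-transfer : (D₁ D₂ : Digraph n) (f g : SignFun n) →
  (∀ x → Good D₁ f x → Good D₂ g x) → IsMODF D₁ f → IsMODF D₂ g
IsMODF-transfer {n} D₁ D₂ f g good⇒good modf =
  ℕP.≤-trans modf (ℕP.*-monoʳ-≤ 2
    (count-mono (closedOutSum D₁ f) (closedOutSum D₂ g) good⇒good (allFin n)))

weight-cong : (f g : SignFun n) → (∀ z → f z ≡ g z) → weight f ≡ weight g
weight-cong {n} f g f≗g = cong sumℤ (ListP.map-cong (λ z → cong val (f≗g z)) (allFin n))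

IsMODF-cong : (D : Digraph n) (f g : SignFun n) → (∀ z → f z ≡ g z) → IsMODF D f → IsMODF D g
IsMODF-cong {n} D f g f≗g = IsMODF-transfer D D f g λ x → subst (1ℤ ≤_) (closed-cong x)
  where
  closed-cong : ∀ x → closedOutSum D f x ≡ closedOutSum D g x
  closed-cong x = cong₂ _+_ (cong val (f≗g x)) (cong sumℤ (ListP.map-cong
    (λ w → cong (λ b → if D x w then val b else 0ℤ) (f≗g w)) (allFin n)))

raise : SignFun n → Fin n → SignFun n
raise f y z = if ⌊ z ≟ y ⌋ then true else f z

raise-at : (f : SignFun n) (y : Fin n) → raise f y y ≡ true
raise-at f y with y ≟ y
... | yes _   = refl
... | no y≢y  = ⊥-elim (y≢y refl)

raise-elsewhere : (f : SignFun n) (y z : Fin n) → z ≢ y → raise f y z ≡ f z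
raise-elsewhere f y z z≢y with z ≟ y
... | yes z≡y = ⊥-elim (z≢y z≡y)
... | no _    = refl

⊑-raise : (f : SignFun n) (y : Fin n) → f ⊑ raise f y
⊑-raise f y z fz with z ≟ y
... | yes _ = refl
... | no _  = fz

weight-split : (f : SignFun n) → weight f ≡ sumFin (λ w → val (f w))
weight-split f = cong sumℤ (ListP.map-tabulate (λ w → w) (λ w → val (f w)))

weight-raise : (f : SignFun n) (y : Fin n) → f y ≡ false → weight (raise f y) ≤ weight f + + 2
weight-raise f y fy rewrite weight-split (raise f y) | weight-split f =
  subst (_≤ _) (ℤP.+-identityʳ _)
    (sumFin-≤-except (λ w → val (raise f y w)) (λ w → val (f w)) y 0ℤ (+ 2)
      (λ z z≢y → ℤP.≤-reflexive (cong val (raise-elsewhere f y z z≢y)))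
      (subst₂ (λ b c → val b + 0ℤ ≤ val c + + 2) (sym (raise-at f y)) (sym fy) ℤP.≤-refl))

outSum-raise : (D : Digraph n) (f : SignFun n) (x w : Fin n) → D x w ≡ true → f w ≡ false →
  outSum D f x + + 2 ≤ outSum D (raise f w) x
outSum-raise D f x w xw∈D fw =
  subst (_ ≤_) (ℤP.+-identityʳ _)
    (sumFin-≤-except (term D f x) (term D (raise f w) x) w (+ 2) 0ℤ
      (λ z _ → term-mono D D f (raise f w) x z refl (⊑-raise f w))
      at-w)
  where
  at-w : term D f x w + + 2 ≤ term D (raise f w) x w + 0ℤ
  at-w rewrite raise-at f w | xw∈D | fw = ℤP.≤-refl

-- The reversal step

SameOutside : Digraph n → Digraph n → Fin n → Fin n → Set
SameOutside {n} D₁ D₂ a b =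
  (x y : Fin n) → ¬ (x ≡ a × y ≡ b) → ¬ (x ≡ b × y ≡ a) → D₁ x y ≡ D₂ x y

SameOutside-sym : (D₁ D₂ : Digraph n) (a b : Fin n) → SameOutside D₁ D₂ a b → SameOutside D₂ D₁ b a
SameOutside-sym D₁ D₂ a b same x y ¬ba ¬ab = sym (same x y ¬ab ¬ba)

module Reversal {n : ℕ} (D₁ D₂ : Digraph n) (a b : Fin n)
                (same : SameOutside D₁ D₂ a b) (ba∈D₂ : D₂ b a ≡ true) where

  outSum-a-slack : (f g : SignFun n) → f ⊑ g → outSum D₁ f a ≤ outSum D₂ g a + + 2
  outSum-a-slack f g f⊑g =
    subst (_≤ _) (ℤP.+-identityʳ _)
      (sumFin-≤-except (term D₁ f a) (term D₂ g a) b 0ℤ (+ 2) unchanged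
        (subst (_≤ _) (sym (ℤP.+-identityʳ _)) (term-slack D₁ D₂ f g a b)))
    where
    unchanged : ∀ z → z ≢ b → term D₁ f a z ≤ term D₂ g a z
    unchanged z z≢b = term-mono D₁ D₂ f g a z
      (same a z (λ (_ , z≡b) → z≢b z≡b) (λ (a≡b , z≡a) → z≢b (trans z≡a a≡b))) f⊑g

  -- Every vertex other than a keeps its closed sum, provided g(a) = +1
  -- (this covers b, whose new arc ba points at a positive vertex).
  closedOutSum-away-from-a : (f g : SignFun n) → f ⊑ g → g a ≡ true → (x : Fin n) → x ≢ a →
    closedOutSum D₁ f x ≤ closedOutSum D₂ g x
  closedOutSum-away-from-a f g f⊑g ga x x≢a = closedOutSum-mono D₁ D₂ f g x f⊑g terms
    where
    terms : ∀ w → term D₁ f x w ≤ term D₂ g x w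
    terms w with x ≟ b | w ≟ a
    ... | yes refl | yes refl = term-max D₁ D₂ f g b a ba∈D₂ ga
    ... | yes _    | no w≢a   = term-mono D₁ D₂ f g x w
                                  (same x w (λ (x≡a , _) → x≢a x≡a) (λ (_ , w≡a) → w≢a w≡a)) f⊑g
    ... | no x≢b   | _        = term-mono D₁ D₂ f g x w
                                  (same x w (λ (x≡a , _) → x≢a x≡a) (λ (x≡b , _) → x≢b x≡b)) f⊑g

  transfer : (f g : SignFun n) → f ⊑ g → g a ≡ true → (Good D₁ f a → Good D₂ g a) →
    IsMODF D₁ f → IsMODF D₂ g
  transfer f g f⊑g ga a-good = IsMODF-transfer D₁ D₂ f g good⇒good
    where
    good⇒good : ∀ x → Good D₁ f x → Good D₂ g x
    good⇒good x good with x ≟ a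
    ... | yes refl = a-good good
    ... | no x≢a   = ℤP.≤-trans good (closedOutSum-away-from-a f g f⊑g ga x x≢a)

  -- Case f(a) = -1: raising a gains 2 at a, compensating the lost arc.
  raise-negative-a : (f : SignFun n) → f a ≡ false →
    closedOutSum D₁ f a ≤ closedOutSum D₂ (raise f a) a
  raise-negative-a f fa
    rewrite closedOutSum-split D₁ f a | closedOutSum-split D₂ (raise f a) a | raise-at f a | fa =
    begin
      -[1+ 0 ] + outSum D₁ f a                ≤⟨ ℤP.+-monoʳ-≤ -[1+ 0 ] (outSum-a-slack f g (⊑-raise f a)) ⟩
      -[1+ 0 ] + (outSum D₂ g a + + 2)        ≡⟨ cong (λ s → -[1+ 0 ] + s) (ℤP.+-comm (outSum D₂ g a) (+ 2)) ⟩
      -[1+ 0 ] + (+ 2 + outSum D₂ g a)        ≡⟨ ℤP.+-assoc -[1+ 0 ] (+ 2) (outSum D₂ g a) ⟨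
      1ℤ + outSum D₂ g a                      ∎
    where
    open ℤP.≤-Reasoning
    g : SignFun n
    g = raise f a

  raise-negative-neighbour : (f : SignFun n) (w : Fin n) → D₂ a w ≡ true → f w ≡ false →
    closedOutSum D₁ f a ≤ closedOutSum D₂ (raise f w) a
  raise-negative-neighbour f w aw∈D₂ fw
    rewrite closedOutSum-split D₁ f a | closedOutSum-split D₂ (raise f w) a =
    ℤP.+-mono-≤ (val-mono (f a) (raise f w a) (⊑-raise f w a))
      (ℤP.≤-trans (outSum-a-slack f f (⊑-refl f)) (outSum-raise D₂ f a w aw∈D₂ fw))

  reverse-step : (f : SignFun n) → IsMODF D₁ f →
    Σ (SignFun n) (λ g → IsMODF D₂ g × weight g ≤ weight f + + 2)
  reverse-step f modf with f a in fa
  ... | false = raise f a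
              , transfer f (raise f a) (⊑-raise f a) (raise-at f a)
                  (λ good → ℤP.≤-trans good (raise-negative-a f fa)) modf
              , weight-raise f a fa
  ... | true with any? (λ w → (D₂ a w BoolP.≟ true) ×-dec (f w BoolP.≟ false))
  ...   | yes (w , aw∈D₂ , fw) =
            raise f w
          , transfer f (raise f w) (⊑-raise f w) (⊑-raise f w a fa)
              (λ good → ℤP.≤-trans good (raise-negative-neighbour f w aw∈D₂ fw)) modf
          , weight-raise f w fw
  ...   | no no-negative =
            f
          , transfer f f (⊑-refl f) fa (λ _ → positive-closed-neighbourhood D₂ f a fa no-negative) modf
          , ℤP.i≤i+j (weight f) (+ 2)

  gamma-step : (k k′ : ℤ) → IsGammaMaj D₁ k → IsGammaMaj D₂ k′ → k′ ≤ k + + 2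
  gamma-step k k′ ((f , modf , refl) , _) (_ , minimal′) with reverse-step f modf
  ... | g , modg , wg≤wf+2 = ℤP.≤-trans (minimal′ g modg) wg≤wf+2

pair-test-false : (x y x′ y′ : Fin n) → ¬ (x ≡ x′ × y ≡ y′) → (⌊ x ≟ x′ ⌋ ∧ ⌊ y ≟ y′ ⌋) ≡ false
pair-test-false x y x′ y′ ≢pair with x ≟ x′ | y ≟ y′
... | yes x≡x′ | yes y≡y′ = ⊥-elim (≢pair (x≡x′ , y≡y′))
... | yes _    | no _     = refl
... | no _     | _        = refl

reverseArc-outside : (D : Digraph n) (u v : Fin n) → SameOutside D (reverseArc D u v) u v
reverseArc-outside D u v x y ≢uv ≢vu
  rewrite pair-test-false x y v u ≢vu | pair-test-false x y u v ≢uv = refl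

reverseArc-reversed : (D : Digraph n) (u v : Fin n) → reverseArc D u v v u ≡ true
reverseArc-reversed D u v with v ≟ v | u ≟ u
... | yes _  | yes _  = refl
... | no v≢v | _      = ⊥-elim (v≢v refl)
... | yes _  | no u≢u = ⊥-elim (u≢u refl)

-- Both bounds: D ⇝ D' along (u, v), and D' ⇝ D along (v, u) since uv ∈ D.
reversal-bounds : (D : Digraph n) (u v : Fin n) → D u v ≡ true → (k k′ : ℤ) →
  IsGammaMaj D k → IsGammaMaj (reverseArc D u v) k′ → (k - + 2 ≤ k′) × (k′ ≤ k + + 2)
reversal-bounds {n} D u v uv∈D k k′ γ γ′ = lower , upper
  where
  D′ : Digraph n
  D′ = reverseArc D u v
  upper : k′ ≤ k + + 2
  upper = Reversal.gamma-step D D′ u v (reverseArc-outside D u v) (reverseArc-reversed D u v) k k′ γ γ′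
  k≤k′+2 : k ≤ k′ + + 2
  k≤k′+2 = Reversal.gamma-step D′ D v u (SameOutside-sym D D′ u v (reverseArc-outside D u v)) uv∈D k′ k γ′ γ
  lower : k - + 2 ≤ k′
  lower = begin
    k - + 2              ≤⟨ ℤP.+-monoˡ-≤ (- + 2) k≤k′+2 ⟩
    (k′ + + 2) - + 2     ≡⟨ ℤP.+-assoc k′ (+ 2) (- + 2) ⟩
    k′ + (+ 2 - + 2)     ≡⟨ ℤP.+-identityʳ k′ ⟩
    k′                   ∎
    where open ℤP.≤-Reasoning

all-vectors? : {P : Vec Bool n → Set} → (∀ s → Dec (P s)) → Dec (∀ s → P s)
all-vectors? {zero}  P? = map′ (λ p → λ { [] → p }) (λ all → all []) (P? [])
all-vectors? {suc n} P? =
  map′ (λ (pt , pf) → λ { (true ∷ s) → pt s ; (false ∷ s) → pf s })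
       (λ all → (λ s → all (true ∷ s)) , (λ s → all (false ∷ s)))
       (all-vectors? (λ s → P? (true ∷ s)) ×-dec all-vectors? (λ s → P? (false ∷ s)))

MinimalAmongVectors : Digraph n → Vec Bool n → Set
MinimalAmongVectors {n} D s =
  (t : Vec Bool n) → IsMODF D (lookup t) → weight (lookup s) ≤ weight (lookup t)

IsMODF? : (D : Digraph n) (f : SignFun n) → Dec (IsMODF D f)
IsMODF? {n} D f = n ℕP.≤? 2 ℕ.* goodCount D f

minimal-among-vectors? : (D : Digraph n) (s : Vec Bool n) → Dec (MinimalAmongVectors D s)
minimal-among-vectors? D s =
  all-vectors? λ t → IsMODF? D (lookup t) →-dec (weight (lookup s) ℤ.≤? weight (lookup t))

-- Every sign function is represented by the vector of its values, so a MODF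
-- of minimum weight among vectors determines γ⁺maj.
IsGammaMaj-from-vector : (D : Digraph n) (s : Vec Bool n) → IsMODF D (lookup s) →
  MinimalAmongVectors D s → IsGammaMaj D (weight (lookup s))
IsGammaMaj-from-vector {n} D s modf minimal = (lookup s , modf , refl) , below-all
  where
  below-all : (f : SignFun n) → IsMODF D f → weight (lookup s) ≤ weight f
  below-all f modf-f =
    subst (weight (lookup s) ≤_) (weight-cong _ f (lookup∘tabulate f))
      (minimal (Vec.tabulate f) (IsMODF-cong D f _ (λ z → sym (lookup∘tabulate f z)) modf-f))

IsGammaMaj-by-search : (D : Digraph n) (s : Vec Bool n) →
  {True (IsMODF? D (lookup s))} → {True (minimal-among-vectors? D s)} →
  IsGammaMaj D (weight (lookup s))
IsGammaMaj-by-search D s {modf} {minimal} =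
  IsGammaMaj-from-vector D s (toWitness modf) (toWitness minimal)

-- Sharpness examples

-- The 2-cycle 0 ⇄ 1 needs both vertices +1, so γ⁺maj = 2; after reversing 01
-- only the arc 10 remains and f = (+1, -1) makes vertex 0 good: γ⁺maj = 0.
two-cycle : Digraph 2
two-cycle zero       (suc zero) = true
two-cycle (suc zero) zero       = true
two-cycle _          _          = false

two-cycle-loopless : Loopless two-cycle
two-cycle-loopless zero       = refl
two-cycle-loopless (suc zero) = refl

two-cycle-γ : IsGammaMaj two-cycle (+ 2)
two-cycle-γ = IsGammaMaj-by-search two-cycle (true ∷ true ∷ [])

two-cycle-reversed-γ : IsGammaMaj (reverseArc two-cycle zero (suc zero)) 0ℤ
two-cycle-reversed-γ = IsGammaMaj-by-search (reverseArc two-cycle zero (suc zero)) (true ∷ false ∷ [])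

-- Arcs 01, 02, 21: γ⁺maj = 1 via (+1, +1, -1).  Reversing 01 gives the
-- directed 3-cycle 0 → 2 → 1 → 0, where a good vertex and its successor are
-- +1; two good vertices then force f ≡ +1, so γ⁺maj = 3.
transitive-triangle : Digraph 3
transitive-triangle zero             (suc zero)       = true
transitive-triangle zero             (suc (suc zero)) = true
transitive-triangle (suc (suc zero)) (suc zero)       = true
transitive-triangle _                _                = false

transitive-triangle-loopless : Loopless transitive-triangle
transitive-triangle-loopless zero             = refl
transitive-triangle-loopless (suc zero)       = refl
transitive-triangle-loopless (suc (suc zero)) = refl

transitive-triangle-γ : IsGammaMaj transitive-triangle 1ℤ
transitive-triangle-γ = IsGammaMaj-by-search transitive-triangle (true ∷ true ∷ false ∷ [])

transitive-triangle-reversed-γ : IsGammaMaj (reverseArc transitive-triangle zero (suc zero)) (+ 3)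
transitive-triangle-reversed-γ =
  IsGammaMaj-by-search (reverseArc transitive-triangle zero (suc zero)) (true ∷ true ∷ true ∷ [])

theorem3p8 :
    ((n : ℕ) (D : Digraph n) → Loopless D → (u v : Fin n) → D u v ≡ true →
      (k k′ : ℤ) → IsGammaMaj D k → IsGammaMaj (reverseArc D u v) k′ →
      (k - + 2 ≤ k′) × (k′ ≤ k + + 2))
    × Σ ℕ (λ n → Σ (Digraph n) (λ D → Loopless D × Σ (Fin n) (λ u → Σ (Fin n) (λ v →
        D u v ≡ true × Σ ℤ (λ k → Σ ℤ (λ k′ →
          IsGammaMaj D k × IsGammaMaj (reverseArc D u v) k′ × k′ ≡ k - + 2))))))
    × Σ ℕ (λ n → Σ (Digraph n) (λ D → Loopless D × Σ (Fin n) (λ u → Σ (Fin n) (λ v →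
        D u v ≡ true × Σ ℤ (λ k → Σ ℤ (λ k′ →
          IsGammaMaj D k × IsGammaMaj (reverseArc D u v) k′ × k′ ≡ k + + 2))))))
theorem3p8 =
    (λ n D _ u v uv∈D → reversal-bounds D u v uv∈D)
  , (2 , two-cycle , two-cycle-loopless , zero , suc zero , refl
       , + 2 , 0ℤ , two-cycle-γ , two-cycle-reversed-γ , refl)
  , (3 , transitive-triangle , transitive-triangle-loopless , zero , suc zero , refl
       , 1ℤ , + 3 , transitive-triangle-γ , transitive-triangle-reversed-γ , refl)
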